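{- Let $G$ and $H$ be finite simple connected graphs, each with at least two vertices. If $o(H)\in\{\mathcal{N},\mathcal{S}\}$, then $o(G\circ H)=\mathcal{S}$.
   Context: The lexicographic product $G\circ H$ has vertex set $V(G)\times V(H)$, with $(g,h)(g',h')$ an edge iff $gg'\in E(G)$, or $g=g'$ and $hh'\in E(H)$. A set $W\subseteq V(X)$ is a resolving set of a connected graph $X$ if for every two distinct vertices $x,y$ there is $z\in W$ with $d(x,z)\ne d(y,z)$. In the Maker-Breaker resolving game on $X$, Resolver and Spoiler alternately select unplayed vertices of $X$; Resolver wins if the vertices he selects contain a resolving set of $X$, and Spoiler wins if she selects at least one vertex of every resolving set of $X$. The outcome $o(X)$ is $\mathcal{R}$ if Resolver has a winning strategy no matter who starts, $\mathcal{S}$ if Spoiler has a winning strategy no matter who starts, and $\mathcal{N}$ if the first player has a winning strategy. -}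

module Defs where

open import Data.Nat using (ℕ; zero; suc; _<_)
open import Data.Fin using (Fin)
open import Data.Product using (Σ; ∃; ∃-syntax; _×_; _,_)
open import Data.Sum using (_⊎_; inj₁; inj₂)
open import Data.Empty using (⊥)
open import Data.List using (List; []; _∷_)
open import Data.List.Membership.Propositional using (_∈_; _∉_)
open import Relation.Nullary using (¬_)
open import Relation.Binary.PropositionalEquality using (_≡_; _≢_; refl; sym)

record Graph (V : Set) : Set₁ where
  field
    Adj    : V → V → Set
    irrefl : ∀ x → ¬ Adj x x
    symm   : ∀ {x y} → Adj x y → Adj y x
open Graph public

_∘ₗ_ : ∀ {A B : Set} → Graph A → Graph B → Graph (A × B)
_∘ₗ_ {A} {B} G H = record { Adj = adj ; irrefl = irr ; symm = sy }
  where
  adj : A × B → A × B → Set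
  adj (g , h) (g' , h') = Adj G g g' ⊎ (g ≡ g' × Adj H h h')
  irr : ∀ x → ¬ adj x x
  irr (g , h) (inj₁ a) = irrefl G g a
  irr (g , h) (inj₂ (_ , a)) = irrefl H h a
  sy : ∀ {x y} → adj x y → adj y x
  sy (inj₁ a) = inj₁ (symm G a)
  sy (inj₂ (refl , a)) = inj₂ (refl , symm H a)

data Walk {V : Set} (G : Graph V) : ℕ → V → V → Set where
  here : ∀ {x} → Walk G zero x x
  step : ∀ {k x y z} → Adj G x y → Walk G k y z → Walk G (suc k) x z

Connected : ∀ {V : Set} → Graph V → Set
Connected G = ∀ x y → ∃[ k ] Walk G k x y

Dist : ∀ {V : Set} → Graph V → V → V → ℕ → Set
Dist G x y k = Walk G k x y × (∀ m → m < k → ¬ Walk G m x y)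

IsResolving : ∀ {V : Set} → Graph V → (V → Set) → Set
IsResolving {V} G W =
  ∀ x y → x ≢ y →
    ∃[ z ] (W z × ∃[ k₁ ] ∃[ k₂ ] (Dist G x z k₁ × Dist G y z k₂ × k₁ ≢ k₂))

-- Maker-Breaker resolving game.
-- A position is the pair (rs , ss) of vertices chosen so far by
-- Resolver and by Spoiler.

data Outcome : Set where
  𝓡 𝓝 𝓢 : Outcome

data Player : Set where
  resolver spoiler : Player

module _ {V : Set} (G : Graph V) where

  Unplayed : List V → List V → V → Set
  Unplayed rs ss v = v ∉ rs × v ∉ ss

  ResolverWon : List V → Set₁
  ResolverWon rs = Σ (V → Set) λ W → (∀ v → W v → v ∈ rs) × IsResolving G W

  SpoilerWon : List V → Set₁
  SpoilerWon ss = ∀ (W : V → Set) → IsResolving G W → ∃[ v ] (W v × v ∈ ss)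

  -- ResolverWins p rs ss : from position (rs , ss) with player p to move,
  -- Resolver has a winning strategy.
  data ResolverWins : Player → List V → List V → Set₁ where
    rdone : ∀ {p rs ss} → ResolverWon rs → ResolverWins p rs ss
    rmove : ∀ {rs ss} v → Unplayed rs ss v →
            ResolverWins spoiler (v ∷ rs) ss → ResolverWins resolver rs ss
    smove : ∀ {rs ss} → ∃[ u ] Unplayed rs ss u →
            (∀ v → Unplayed rs ss v → ResolverWins resolver rs (v ∷ ss)) →
            ResolverWins spoiler rs ss

  -- SpoilerWins p rs ss : from position (rs , ss) with player p to move,
  -- Spoiler has a winning strategy.
  data SpoilerWins : Player → List V → List V → Set₁ where
    sdone  : ∀ {p rs ss} → SpoilerWon ss → SpoilerWins p rs ss
    smove' : ∀ {rs ss} v → Unplayed rs ss v →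
             SpoilerWins resolver rs (v ∷ ss) → SpoilerWins spoiler rs ss
    rmove' : ∀ {rs ss} → ∃[ u ] Unplayed rs ss u →
             (∀ v → Unplayed rs ss v → SpoilerWins spoiler (v ∷ rs) ss) →
             SpoilerWins resolver rs ss

  HasOutcome : Outcome → Set₁
  HasOutcome 𝓡 = ResolverWins resolver [] [] × ResolverWins spoiler [] []
  HasOutcome 𝓢 = SpoilerWins resolver [] [] × SpoilerWins spoiler [] []
  HasOutcome 𝓝 = ResolverWins resolver [] [] × SpoilerWins spoiler [] []

{-# OPTIONS --safe #-}
-- Spoiler commits to a copy {g₀} × H of H, where g₀ avoids Resolver's first move (if he starts)
-- and has a neighbour in G, and plays her winning H-strategy inside that copy, answering
-- Resolver's moves elsewhere arbitrarily. This works because of the distances in G ∘ H: a vertex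
-- outside the copy is equidistant from all vertices of the copy, and inside it
-- d((g₀,h),(g₀,z)) = min(2, d_H(h,z)). So two vertices of the copy are separated only by vertices
-- of the copy, which separate them in H as well: the part of any resolving set of G ∘ H inside
-- the copy resolves H, and Spoiler's win in H meets it.
module Submission where

open import Defs
open import Data.Nat using (ℕ; zero; suc; _≤_; _<_; _⊓_; z≤n; s≤s; z<s)
open import Data.Nat.Properties
  using (≤-antisym; ≤-trans; ≮⇒≥; m≤n⇒m≤1+n; m<n⇒m<1+n; anyUpTo?)
open import Data.Nat.Induction using (<-wellFounded)
open import Data.Fin using (Fin; zero; suc; _≟_; punchIn)
open import Data.Fin.Properties using (any?; punchInᵢ≢i)
open import Data.Sum using (_⊎_; inj₁; inj₂; [_,_]′)
import Data.Sum as Sum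
open import Data.Product using (∃; ∃-syntax; _×_; _,_; proj₁; proj₂)
import Data.Product as Product
open import Data.Product.Properties using (≡-dec)
open import Data.List using (List; []; _∷_; length; filter; map; allFin; cartesianProduct)
open import Data.List.Properties using (filter-accept; filter-reject)
open import Data.List.Relation.Unary.Any using (here; there; satisfied)
import Data.List.Relation.Unary.Any as Any
open import Data.List.Membership.Propositional using (_∈_; _∉_; lose)
open import Data.List.Membership.Propositional.Properties
  using (∈-map⁺; ∈-cartesianProduct⁺; ∈-allFin)
import Data.List.Membership.DecPropositional as DecMembership
open import Data.List.Relation.Binary.Subset.Propositional using (_⊆_)
open import Data.List.Relation.Binary.Subset.Propositional.Properties
  using (⊆-trans; xs⊆x∷xs; ∷⁺ʳ; ∈-∷⁺ʳ)
open import Data.Empty using (⊥; ⊥-elim)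
open import Function using (_∘_; id)
open import Induction.WellFounded using (Acc; acc)
open import Relation.Nullary using (¬_; Dec; yes; no)
open import Relation.Nullary.Decidable using (_×-dec_; ¬?; map′; ¬¬-excluded-middle)
open import Relation.Unary using (Decidable)
open import Relation.Binary.Definitions using (DecidableEquality)
open import Relation.Binary.PropositionalEquality
  using (_≡_; _≢_; refl; sym; cong; subst; module ≡-Reasoning)

module _ {V : Set} {X : Graph V} where

  walk-zero : ∀ {x y} → Walk X 0 x y → x ≡ y
  walk-zero here = refl

  walk-one : ∀ {x y} → Walk X 1 x y → Adj X x y
  walk-one (step xy here) = xy

  Dist-functional : ∀ {x y a b} → Dist X x y a → Dist X x y b → a ≡ b
  Dist-functional (wa , min-a) (wb , min-b) =
    ≤-antisym (≮⇒≥ λ b<a → min-a _ b<a wb) (≮⇒≥ λ a<b → min-b _ a<b wa)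

  Dist-suc⇒≢ : ∀ {x y a} → Dist X x y (suc a) → x ≢ y
  Dist-suc⇒≢ (_ , minimal) refl = minimal 0 z<s here

  Dist-≥2⇒non-adjacent : ∀ {x y a} → Dist X x y (suc (suc a)) → ¬ Adj X x y
  Dist-≥2⇒non-adjacent (_ , minimal) xy = minimal 1 (s≤s z<s) (step xy here)

  has-neighbour : Connected X → ∀ {x y} → x ≢ y → ∃[ x' ] Adj X x x'
  has-neighbour connected {x} {y} x≢y with connected x y
  ... | zero , w = ⊥-elim (x≢y (walk-zero w))
  ... | suc _ , step xx' _ = _ , xx'

minimal-witness : ∀ {P : ℕ → Set} → Decidable P → ∀ {k} → P k →
                  ∃[ j ] (P j × (∀ i → i < j → ¬ P i))
minimal-witness {P} P? = go (<-wellFounded _)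
  where
  go : ∀ {k} → Acc _<_ k → P k → ∃[ j ] (P j × (∀ i → i < j → ¬ P i))
  go {k} (acc smaller) pk with anyUpTo? P? k
  ... | yes (j , j<k , pj) = go (smaller j<k) pj
  ... | no none = k , pk , λ i i<k pi → none (i , i<k , pi)

¬¬-∀-Fin : ∀ {k} {P : Fin k → Set} → (∀ i → ¬ ¬ P i) → ¬ ¬ (∀ i → P i)
¬¬-∀-Fin {zero} _ ¬all = ¬all λ ()
¬¬-∀-Fin {suc k} ¬¬p ¬all =
  ¬¬p zero λ p₀ → ¬¬-∀-Fin (¬¬p ∘ suc) λ pₛ → ¬all λ { zero → p₀ ; (suc i) → pₛ i }

module _ {m} (H : Graph (Fin m)) where

  ¬¬-adjacency-decidable : ¬ ¬ (∀ x y → Dec (Adj H x y))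
  ¬¬-adjacency-decidable = ¬¬-∀-Fin λ x → ¬¬-∀-Fin λ y → ¬¬-excluded-middle

  module _ (adj? : ∀ x y → Dec (Adj H x y)) where

    walk? : ∀ k x y → Dec (Walk H k x y)
    walk? zero x y with x ≟ y
    ... | yes refl = yes here
    ... | no x≢y = no (x≢y ∘ walk-zero)
    walk? (suc k) x y with any? (λ x' → adj? x x' ×-dec walk? k x' y)
    ... | yes (_ , xx' , w) = yes (step xx' w)
    ... | no none = no λ { (step xx' w) → none (_ , xx' , w) }

    distance : Connected H → ∀ x y → ∃[ k ] Dist H x y k
    distance connected x y = minimal-witness (λ k → walk? k x y) (proj₂ (connected x y))

module _ {A B : Set} {G : Graph A} {H : Graph B} where

  walk-projection : ∀ {k x y} → Walk (G ∘ₗ H) k x y →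
                    ∃[ ℓ ] (ℓ ≤ k × Walk G ℓ (proj₁ x) (proj₁ y))
  walk-projection here = 0 , z≤n , here
  walk-projection (step (inj₁ gg') w) with walk-projection w
  ... | ℓ , ℓ≤k , w' = suc ℓ , s≤s ℓ≤k , step gg' w'
  walk-projection (step (inj₂ (g≡g' , _)) w) with walk-projection w
  ... | ℓ , ℓ≤k , w' = ℓ , m≤n⇒m≤1+n ℓ≤k , subst (λ g → Walk G ℓ g _) (sym g≡g') w'

  walk-lift : ∀ {ℓ g g' h h'} → Walk G (suc ℓ) g g' →
              Walk (G ∘ₗ H) (suc ℓ) (g , h) (g' , h')
  walk-lift (step gg' here) = step (inj₁ gg') here
  walk-lift {h = h} (step gg' w@(step _ _)) = step (inj₁ gg') (walk-lift {h = h} w)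

  private
    dist-other-copy-≤ : ∀ {g g' h₁ h₂ z k₁ k₂} → g ≢ g' →
                        Dist (G ∘ₗ H) (g , h₁) (g' , z) k₁ →
                        Dist (G ∘ₗ H) (g , h₂) (g' , z) k₂ → k₂ ≤ k₁
    dist-other-copy-≤ g≢g' (w₁ , _) (_ , minimal₂) with walk-projection w₁
    ... | zero , _ , w = ⊥-elim (g≢g' (walk-zero w))
    ... | suc ℓ , ℓ≤k₁ , w = ≤-trans (≮⇒≥ λ ℓ<k₂ → minimal₂ _ ℓ<k₂ (walk-lift w)) ℓ≤k₁

  dist-other-copy : ∀ {g g' h₁ h₂ z k₁ k₂} → g ≢ g' →
                    Dist (G ∘ₗ H) (g , h₁) (g' , z) k₁ →
                    Dist (G ∘ₗ H) (g , h₂) (g' , z) k₂ → k₁ ≡ k₂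
  dist-other-copy g≢g' D₁ D₂ =
    ≤-antisym (dist-other-copy-≤ g≢g' D₂ D₁) (dist-other-copy-≤ g≢g' D₁ D₂)

  -- Written 2 ⊓ a rather than a ⊓ 2, so that it computes once a is split into 0, 1 and 2+.
  dist-same-copy : ∀ {g g' h z a} → Adj G g g' → Dist H h z a →
                   Dist (G ∘ₗ H) (g , h) (g , z) (2 ⊓ a)
  dist-same-copy {a = zero} _ (w , _) with walk-zero w
  ... | refl = here , λ _ ()
  dist-same-copy {a = suc zero} _ D@(w , _) = step (inj₂ (refl , walk-one w)) here , minimal
    where
    minimal : ∀ i → i < 1 → ¬ Walk (G ∘ₗ H) i _ _
    minimal zero _ w₀ = Dist-suc⇒≢ D (cong proj₂ (walk-zero w₀))
    minimal (suc _) (s≤s ())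
  dist-same-copy {g} {g'} {h} {a = suc (suc _)} gg' D =
    step {y = g' , h} (inj₁ gg') (step (inj₁ (symm G gg')) here) , minimal
    where
    minimal : ∀ i → i < 2 → ¬ Walk (G ∘ₗ H) i _ _
    minimal zero _ w₀ = Dist-suc⇒≢ D (cong proj₂ (walk-zero w₀))
    minimal (suc zero) _ w₁ with walk-one w₁
    ... | inj₁ gg = irrefl G g gg
    ... | inj₂ (_ , hz) = Dist-≥2⇒non-adjacent D hz
    minimal (suc (suc _)) (s≤s (s≤s ()))

  same-copy-separation : ∀ {g g' h h' z k₁ k₂ a b} → Adj G g g' →
                         Dist (G ∘ₗ H) (g , h) (g , z) k₁ → Dist (G ∘ₗ H) (g , h') (g , z) k₂ →
                         k₁ ≢ k₂ → Dist H h z a → Dist H h' z b → a ≢ b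
  same-copy-separation {a = a} {b} gg' D₁ D₂ k₁≢k₂ Da Db a≡b = k₁≢k₂ (begin
    _      ≡⟨ Dist-functional D₁ (dist-same-copy gg' Da) ⟩
    2 ⊓ a  ≡⟨ cong (2 ⊓_) a≡b ⟩
    2 ⊓ b  ≡⟨ Dist-functional (dist-same-copy gg' Db) D₂ ⟩
    _      ∎)
    where open ≡-Reasoning

Blocking : ∀ {V : Set} → Graph V → (V → Set) → Set₁
Blocking X S = ∀ W → IsResolving X W → ∃[ v ] (W v × S v)

SpoilerWins⇒blocking : ∀ {V : Set} {X : Graph V} {p rs ss} {S : V → Set} →
                       SpoilerWins X p rs ss → (∀ {v} → v ∈ ss → S v) → (∀ v → v ∈ rs ⊎ S v) →
                       Blocking X S
SpoilerWins⇒blocking (sdone won) ss⊆S _ W resolving =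
  Product.map₂ (Product.map₂ ss⊆S) (won W resolving)
SpoilerWins⇒blocking {S = S} (smove' v (v∉rs , _) t) ss⊆S covered =
  SpoilerWins⇒blocking t v∷ss⊆S covered
  where
  v∷ss⊆S : ∀ {u} → u ∈ v ∷ _ → S u
  v∷ss⊆S (here refl) = [ ⊥-elim ∘ v∉rs , id ]′ (covered v)
  v∷ss⊆S (there u∈ss) = ss⊆S u∈ss
SpoilerWins⇒blocking (rmove' (u , unplayed) respond) ss⊆S covered =
  SpoilerWins⇒blocking (respond u unplayed) ss⊆S (Sum.map₁ there ∘ covered)

module _ {n m} {G : Graph (Fin n)} {H : Graph (Fin m)} (connected : Connected H)
         {g₀ g₁ : Fin n} (g₀g₁ : Adj G g₀ g₁)
         {S : Fin n × Fin m → Set} (S? : Decidable S) where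

  private
    module Separators (W : Fin n × Fin m → Set) (resolving : IsResolving (G ∘ₗ H) W) where

      -- Indexed by the decision of h ≟ h' rather than by a proof of h ≢ h', so that it
      -- depends on h and h' alone and "some separator lies in S" becomes decidable.
      SeparatorInS : (h h' : Fin m) → Dec (h ≡ h') → Set
      SeparatorInS h h' (yes _) = ⊥
      SeparatorInS h h' (no h≢h') =
        S (proj₁ (resolving (g₀ , h) (g₀ , h') (h≢h' ∘ cong proj₂)))

      separatorInS? : ∀ h h' d → Dec (SeparatorInS h h' d)
      separatorInS? h h' (yes _) = no λ ()
      separatorInS? h h' (no _) = S? _

      separatorInS⇒S-meets-W : ∀ h h' d → SeparatorInS h h' d → ∃[ v ] (W v × S v)
      separatorInS⇒S-meets-W h h' (no _) s = _ , proj₁ (proj₂ (resolving _ _ _)) , s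

      separators-outside-resolve : (∀ x y → Dec (Adj H x y)) →
                                   (∀ h h' → ¬ SeparatorInS h h' (h ≟ h')) →
                                   IsResolving H (λ z → ¬ S (g₀ , z))
      separators-outside-resolve adj? outside h h' h≢h' = separate (h ≟ h') (outside h h')
        where
        separate : (d : Dec (h ≡ h')) → ¬ SeparatorInS h h' d →
                   ∃[ z ] (¬ S (g₀ , z) ×
                           ∃[ k₁ ] ∃[ k₂ ] (Dist H h z k₁ × Dist H h' z k₂ × k₁ ≢ k₂))
        separate (yes h≡h') _ = ⊥-elim (h≢h' h≡h')
        separate (no h≢h'') ¬s with resolving (g₀ , h) (g₀ , h') (h≢h'' ∘ cong proj₂)
        ... | (g , z) , _ , _ , _ , D₁ , D₂ , k₁≢k₂ with g ≟ g₀
        ...   | no g≢g₀ = ⊥-elim (k₁≢k₂ (dist-other-copy (g≢g₀ ∘ sym) D₁ D₂))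
        ...   | yes refl with distance H adj? connected h z | distance H adj? connected h' z
        ...     | a , Da | b , Db =
          z , ¬s , a , b , Da , Db , same-copy-separation g₀g₁ D₁ D₂ k₁≢k₂ Da Db

      S-meets-W : Blocking H (λ h → S (g₀ , h)) → ∃[ v ] (W v × S v)
      S-meets-W blocks with any? (λ h → any? λ h' → separatorInS? h h' (h ≟ h'))
      ... | yes (h , h' , s) = separatorInS⇒S-meets-W h h' (h ≟ h') s
      -- Adjacency in H need not be decidable, so distances in H are only available under a
      -- double negation; that suffices because this branch only has to prove ⊥.
      ... | no none = ⊥-elim (¬¬-adjacency-decidable H λ adj? →
        let _ , outside , inside =
              blocks _ (separators-outside-resolve adj? λ h h' s → none (h , h' , s))
        in outside inside)

  copy-blocking : Blocking H (λ h → S (g₀ , h)) → Blocking (G ∘ₗ H) S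
  copy-blocking blocks W resolving = Separators.S-meets-W W resolving blocks

resolver-plays : ∀ {V : Set} {X : Graph V} {rs ss v} → SpoilerWins X resolver rs ss →
                 Unplayed X rs ss v → SpoilerWins X spoiler (v ∷ rs) ss
resolver-plays (sdone won) _ = sdone won
resolver-plays (rmove' _ respond) unplayed = respond _ unplayed

module _ {A : Set} {P Q : A → Set} (P? : Decidable P) (Q? : Decidable Q)
         (Q⇒P : ∀ {x} → Q x → P x) where

  filter-length-mono : ∀ xs → length (filter Q? xs) ≤ length (filter P? xs)
  filter-length-mono [] = z≤n
  filter-length-mono (y ∷ xs) with P? y | Q? y
  ... | yes _  | yes _  = s≤s (filter-length-mono xs)
  ... | yes _  | no _   = m≤n⇒m≤1+n (filter-length-mono xs)
  ... | no ¬py | yes qy = ⊥-elim (¬py (Q⇒P qy))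
  ... | no _   | no _   = filter-length-mono xs

  filter-length-strict-mono : ∀ {x xs} → x ∈ xs → P x → ¬ Q x →
                              length (filter Q? xs) < length (filter P? xs)
  filter-length-strict-mono {x} {_ ∷ xs} (here refl) px ¬qx
    rewrite filter-accept P? {xs = xs} px | filter-reject Q? {xs = xs} ¬qx =
    s≤s (filter-length-mono xs)
  filter-length-strict-mono {xs = y ∷ xs} (there x∈xs) px ¬qx with P? y | Q? y
  ... | yes _  | yes _  = s≤s (filter-length-strict-mono x∈xs px ¬qx)
  ... | yes _  | no _   = m<n⇒m<1+n (filter-length-strict-mono x∈xs px ¬qx)
  ... | no ¬py | yes qy = ⊥-elim (¬py (Q⇒P qy))
  ... | no _   | no _   = filter-length-strict-mono x∈xs px ¬qx

module UnplayedCount {V : Set} (_≟ᵥ_ : DecidableEquality V) (X : Graph V)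
                     (vertices : List V) (∈-vertices : ∀ v → v ∈ vertices) where

  open DecMembership _≟ᵥ_ using (_∈?_)

  unplayed? : ∀ rs ss → Decidable (Unplayed X rs ss)
  unplayed? rs ss v = ¬? (v ∈? rs) ×-dec ¬? (v ∈? ss)

  unplayed-exists? : ∀ rs ss → Dec (∃ (Unplayed X rs ss))
  unplayed-exists? rs ss =
    map′ satisfied (λ (v , unplayed) → lose (∈-vertices v) unplayed)
         (Any.any? (unplayed? rs ss) vertices)

  unplayed-count : List V → List V → ℕ
  unplayed-count rs ss = length (filter (unplayed? rs ss) vertices)

  unplayed-count-resolver : ∀ {rs ss v} → Unplayed X rs ss v →
                            unplayed-count (v ∷ rs) ss < unplayed-count rs ss
  unplayed-count-resolver unplayed = filter-length-strict-mono (unplayed? _ _) (unplayed? _ _)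
    (Product.map₁ (_∘ there)) (∈-vertices _) unplayed (λ (v∉v∷rs , _) → v∉v∷rs (here refl))

  unplayed-count-spoiler : ∀ {rs ss v} → Unplayed X rs ss v →
                           unplayed-count rs (v ∷ ss) < unplayed-count rs ss
  unplayed-count-spoiler unplayed = filter-length-strict-mono (unplayed? _ _) (unplayed? _ _)
    (Product.map₂ (_∘ there)) (∈-vertices _) unplayed (λ (_ , v∉v∷ss) → v∉v∷ss (here refl))

module MirrorStrategy {n m} (G : Graph (Fin n)) (H : Graph (Fin m)) (connected : Connected H)
                      {g₀ g₁ : Fin n} (g₀g₁ : Adj G g₀ g₁) where

  Vertex : Set
  Vertex = Fin n × Fin m

  _≟ᵥ_ : DecidableEquality Vertex
  _≟ᵥ_ = ≡-dec _≟_ _≟_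

  open DecMembership _≟ᵥ_ using (_∈?_)
  open UnplayedCount _≟ᵥ_ (G ∘ₗ H) (cartesianProduct (allFin n) (allFin m))
                     (λ (g , h) → ∈-cartesianProduct⁺ (∈-allFin g) (∈-allFin h))

  record Mirrors (RS SS : List Vertex) (rs ss : List (Fin m)) : Set where
    field
      resolver-copy : ∀ {h} → (g₀ , h) ∈ RS → h ∈ rs
      resolver-lift : map (g₀ ,_) rs ⊆ RS
      spoiler-lift  : map (g₀ ,_) ss ⊆ SS
  open Mirrors

  private variable
    RS SS : List Vertex
    rs ss : List (Fin m)
    p : Player

  resolver-moves-in-copy : ∀ {h} → Mirrors RS SS rs ss → Mirrors ((g₀ , h) ∷ RS) SS (h ∷ rs) ss
  resolver-moves-in-copy M = record
    { resolver-copy = λ { (here refl) → here refl ; (there h∈RS) → there (resolver-copy M h∈RS) }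
    ; resolver-lift = ∷⁺ʳ _ (resolver-lift M)
    ; spoiler-lift  = spoiler-lift M
    }

  resolver-moves-outside : ∀ {g h} → g ≢ g₀ → Mirrors RS SS rs ss → Mirrors ((g , h) ∷ RS) SS rs ss
  resolver-moves-outside g≢g₀ M = record
    { resolver-copy = λ { (here e)     → ⊥-elim (g≢g₀ (sym (cong proj₁ e)))
                        ; (there h∈RS) → resolver-copy M h∈RS }
    ; resolver-lift = ⊆-trans (resolver-lift M) (xs⊆x∷xs _ _)
    ; spoiler-lift  = spoiler-lift M
    }

  spoiler-moves : ∀ {v} → Mirrors RS SS rs ss → Mirrors RS (v ∷ SS) rs ss
  spoiler-moves M = record
    { resolver-copy = resolver-copy M
    ; resolver-lift = resolver-lift M
    ; spoiler-lift  = ⊆-trans (spoiler-lift M) (xs⊆x∷xs _ _)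
    }

  spoiler-owns : ∀ {h} → (g₀ , h) ∈ SS → Mirrors RS SS rs ss → Mirrors RS SS rs (h ∷ ss)
  spoiler-owns owned M = record
    { resolver-copy = resolver-copy M
    ; resolver-lift = resolver-lift M
    ; spoiler-lift  = ∈-∷⁺ʳ owned (spoiler-lift M)
    }

  spoiler-won : SpoilerWon H ss → Mirrors RS SS rs ss → SpoilerWon (G ∘ₗ H) SS
  spoiler-won won M = copy-blocking connected g₀g₁ (_∈? _)
    λ W resolving → Product.map₂ (Product.map₂ (spoiler-lift M ∘ ∈-map⁺ _)) (won W resolving)

  spoiler-won-full-board : SpoilerWins H p rs ss → Mirrors RS SS rs ss →
                           ¬ ∃ (Unplayed (G ∘ₗ H) RS SS) → SpoilerWon (G ∘ₗ H) SS
  spoiler-won-full-board {RS = RS} {SS = SS} t M full =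
    copy-blocking connected g₀g₁ (_∈? _)
      (SpoilerWins⇒blocking t (spoiler-lift M ∘ ∈-map⁺ _) played)
    where
    played : ∀ h → h ∈ _ ⊎ (g₀ , h) ∈ SS
    played h with (g₀ , h) ∈? RS | (g₀ , h) ∈? SS
    ... | yes h∈RS | _        = inj₁ (resolver-copy M h∈RS)
    ... | no _     | yes h∈SS = inj₂ h∈SS
    ... | no h∉RS  | no h∉SS  = ⊥-elim (full (_ , h∉RS , h∉SS))

  -- The recursion is on the number of unplayed vertices of G ∘ H, as the H-strategy does not
  -- shrink when Resolver plays outside the copy. In a spare turn the H-strategy awaits a Resolver
  -- move, and Spoiler plays an arbitrary vertex. Acc is matched only after the with: matched
  -- before it, the termination checker no longer sees that smaller comes from it.
  spoiler-turn   : SpoilerWins H spoiler rs ss → Mirrors RS SS rs ss →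
                   Acc _<_ (unplayed-count RS SS) → SpoilerWins (G ∘ₗ H) spoiler RS SS
  spare-turn     : SpoilerWins H resolver rs ss → Mirrors RS SS rs ss →
                   Acc _<_ (unplayed-count RS SS) → SpoilerWins (G ∘ₗ H) spoiler RS SS
  resolver-turn  : SpoilerWins H resolver rs ss → Mirrors RS SS rs ss →
                   Acc _<_ (unplayed-count RS SS) → SpoilerWins (G ∘ₗ H) resolver RS SS
  resolver-moved : SpoilerWins H resolver rs ss → Mirrors RS SS rs ss →
                   ∀ v → Unplayed (G ∘ₗ H) RS SS v → Acc _<_ (unplayed-count (v ∷ RS) SS) →
                   SpoilerWins (G ∘ₗ H) spoiler (v ∷ RS) SS

  spoiler-turn (sdone won) M _ = sdone (spoiler-won won M)
  spoiler-turn {SS = SS} (smove' h _ t) M a with (g₀ , h) ∈? SS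
  ... | yes owned = spare-turn t (spoiler-owns owned M) a  -- (g₀ , h) was taken in a spare turn
  spoiler-turn {RS = RS} {SS = SS} (smove' h (h∉rs , _) t) M (acc smaller) | no fresh =
    smove' (g₀ , h) unplayed
      (resolver-turn t (spoiler-owns (here refl) (spoiler-moves M))
                       (smaller (unplayed-count-spoiler unplayed)))
    where
    unplayed : Unplayed (G ∘ₗ H) RS SS (g₀ , h)
    unplayed = h∉rs ∘ resolver-copy M , fresh

  spare-turn {RS = RS} {SS = SS} t M a with unplayed-exists? RS SS
  ... | no full = sdone (spoiler-won-full-board t M full)
  spare-turn t M (acc smaller) | yes (v , unplayed) =
    smove' v unplayed
      (resolver-turn t (spoiler-moves M) (smaller (unplayed-count-spoiler unplayed)))

  resolver-turn {RS = RS} {SS = SS} t M a with unplayed-exists? RS SS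
  ... | no full = sdone (spoiler-won-full-board t M full)
  resolver-turn t M (acc smaller) | yes some = rmove' some λ v unplayed →
    resolver-moved t M v unplayed (smaller (unplayed-count-resolver unplayed))

  resolver-moved t M (g , h) (h∉RS , h∉SS) a with g ≟ g₀
  ... | yes refl = spoiler-turn (resolver-plays t h-unplayed) (resolver-moves-in-copy M) a
    where
    h-unplayed : Unplayed H _ _ h
    h-unplayed = h∉RS ∘ resolver-lift M ∘ ∈-map⁺ _ , h∉SS ∘ spoiler-lift M ∘ ∈-map⁺ _
  ... | no g≢g₀  = spare-turn t (resolver-moves-outside g≢g₀ M) a

  mirror-strategy : SpoilerWins H spoiler [] [] → (∀ {h} → (g₀ , h) ∉ RS) →
                    SpoilerWins (G ∘ₗ H) spoiler RS []
  mirror-strategy t outside = spoiler-turn t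
    (record { resolver-copy = ⊥-elim ∘ outside ; resolver-lift = λ () ; spoiler-lift = λ () })
    (<-wellFounded _)

theorem3p2 : ∀ {n m : ℕ} (G : Graph (Fin n)) (H : Graph (Fin m)) →
    2 ≤ n → 2 ≤ m → Connected G → Connected H →
    (HasOutcome H 𝓝 ⊎ HasOutcome H 𝓢) →
    HasOutcome (G ∘ₗ H) 𝓢
theorem3p2 {suc (suc _)} {suc _} G H (s≤s (s≤s z≤n)) (s≤s _) connectedG connectedH outcome =
  resolver-first , spoiler-first
  where
  spoiler-wins-in-H : SpoilerWins H spoiler [] []
  spoiler-wins-in-H = [ proj₂ , proj₂ ]′ outcome

  mirror-in-copy : ∀ g₀ {RS} → (∀ {h} → (g₀ , h) ∉ RS) → SpoilerWins (G ∘ₗ H) spoiler RS []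
  mirror-in-copy g₀ = MirrorStrategy.mirror-strategy G H connectedH
    (proj₂ (has-neighbour connectedG (punchInᵢ≢i g₀ zero ∘ sym))) spoiler-wins-in-H

  spoiler-first : SpoilerWins (G ∘ₗ H) spoiler [] []
  spoiler-first = mirror-in-copy zero λ ()

  resolver-first : SpoilerWins (G ∘ₗ H) resolver [] []
  resolver-first = rmove' ((zero , zero) , (λ ()) , (λ ())) λ (g , _) _ →
    mirror-in-copy (punchIn g zero) λ { (here e) → punchInᵢ≢i g zero (cong proj₁ e) ; (there ()) }
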